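{- Let $(u_n)_{n\ge1}$ and $(v_n)_{n\ge1}$ be sequences of $\mathbf a\mathbf b$-words such that $u_n$ and $v_n$ have degree $n-1$, and let $(c_n)_{n\ge1}$, $(d_n)_{n\ge1}$ be sequences of complex numbers. Then, as formal power series in $x$ with coefficients in $\mathbb C(q)$, $$\Big(\sum_{n\ge1}c_n\,\beta_q(u_n)\frac{x^n}{[n]!}\Big)\cdot\Big(\sum_{n\ge1}d_n\,\beta_q(v_n)\frac{x^n}{[n]!}\Big)=\sum_{n\ge2}\sum_{\substack{i+j=n\\ i,j\ge1}}c_i d_j\big(\beta_q(u_i\,\mathbf a\,v_j)+\beta_q(u_i\,\mathbf b\,v_j)\big)\frac{x^n}{[n]!}.$$
   Context: An $\mathbf a\mathbf b$-word of degree $n-1$ is a word $u=u_1\cdots u_{n-1}$ in the letters $\mathbf a,\mathbf b$. The descent word of $\sigma=\sigma_1\cdots\sigma_n\in\mathfrak S_n$ is the word with $u_i=\mathbf a$ if $\sigma_i<\sigma_{i+1}$ and $u_i=\mathbf b$ otherwise. For a word $u$ of degree $n-1$, $\beta_q(u)=\sum_\sigma q^{\mathrm{inv}(\sigma)}$, summed over $\sigma\in\mathfrak S_n$ with descent word $u$, where $\mathrm{inv}(\sigma)=\#\{i<j:\sigma_i>\sigma_j\}$. $[n]=1+q+\cdots+q^{n-1}$ and $[n]!=[1][2]\cdots[n]$. Juxtaposition denotes concatenation of words. -}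

module Defs where

open import Level using (Level)
open import Data.Nat using (ℕ; zero; suc; _<ᵇ_; _∸_)
open import Data.Bool using (Bool; true; false; if_then_else_)
open import Data.List using (List; []; _∷_; length; concatMap; map; filter)
open import Data.List.Properties using (≡-dec)
open import Relation.Binary.PropositionalEquality using (_≡_; refl)
open import Relation.Nullary using (Dec; yes; no)
open import Algebra.Bundles using (CommutativeRing)

data Letter : Set where
  𝐚 𝐛 : Letter

_≟ₗ_ : (x y : Letter) → Dec (x ≡ y)
𝐚 ≟ₗ 𝐚 = yes refl
𝐚 ≟ₗ 𝐛 = no (λ ())
𝐛 ≟ₗ 𝐚 = no (λ ())
𝐛 ≟ₗ 𝐛 = yes refl

Word : Set
Word = List Letter

_≟w_ : (u v : Word) → Dec (u ≡ v)
_≟w_ = ≡-dec _≟ₗ_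

-- Permutations of {1..n} in one-line notation (each listed exactly once)
insertions : ℕ → List ℕ → List (List ℕ)
insertions x []       = (x ∷ []) ∷ []
insertions x (y ∷ ys) = (x ∷ y ∷ ys) ∷ map (y ∷_) (insertions x ys)

perms : ℕ → List (List ℕ)
perms zero    = [] ∷ []
perms (suc n) = concatMap (insertions (suc n)) (perms n)

descWord : List ℕ → Word
descWord []           = []
descWord (x ∷ [])     = []
descWord (x ∷ y ∷ ys) = (if x <ᵇ y then 𝐚 else 𝐛) ∷ descWord (y ∷ ys)

countGreater : ℕ → List ℕ → ℕ
countGreater x []       = 0
countGreater x (y ∷ ys) = (if y <ᵇ x then 1 else 0) Data.Nat.+ countGreater x ys

inv : List ℕ → ℕ
inv []       = 0
inv (x ∷ xs) = countGreater x xs Data.Nat.+ inv xs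

module Series {c ℓ : Level} (R : CommutativeRing c ℓ) where
  open CommutativeRing R

  pow : Carrier → ℕ → Carrier
  pow x zero    = 1#
  pow x (suc n) = x * pow x n

  sumL : List Carrier → Carrier
  sumL []       = 0#
  sumL (x ∷ xs) = x + sumL xs

  sumRange : ℕ → (ℕ → Carrier) → Carrier
  sumRange zero    f = 0#
  sumRange (suc n) f = sumRange n f + f n

  β : Carrier → Word → Carrier
  β q w = sumL (map (λ σ → pow q (inv σ))
                 (filter (λ σ → descWord σ ≟w w) (perms (suc (length w)))))

  qint : Carrier → ℕ → Carrier
  qint q n = sumRange n (pow q)

  qfact : Carrier → ℕ → Carrier
  qfact q zero    = 1#
  qfact q (suc n) = qfact q n * qint q (suc n)

  cauchy : (ℕ → Carrier) → (ℕ → Carrier) → ℕ → Carrier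
  cauchy A B n = sumRange (suc n) (λ k → A k * B (n ∸ k))

  -- coefficient sequence of  Σ_{n≥1} c_n β_q(u_n) x^n/[n]!,  with finv n = 1/[n]!
  egf : Carrier → (ℕ → Carrier) → (ℕ → Carrier) → (ℕ → Word) → ℕ → Carrier
  egf q finv c u zero    = 0#
  egf q finv c u (suc n) = c (suc n) * β q (u (suc n)) * finv (suc n)

  -- coefficient sequence of
  -- Σ_{n≥2} Σ_{i+j=n, i,j≥1} c_i d_j (β_q(u_i a v_j) + β_q(u_i b v_j)) x^n/[n]!
  -- (for n = 0,1 the inner sum is empty, so the coefficient is 0)
  rhs : Carrier → (ℕ → Carrier) → (ℕ → Carrier) → (ℕ → Word)
        → (ℕ → Carrier) → (ℕ → Word) → ℕ → Carrier
  rhs q finv c u d v n =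
    sumRange (n ∸ 1) (λ k →
      c (suc k) * d (n ∸ suc k)
        * (β q (u (suc k) Data.List.++ 𝐚 ∷ v (n ∸ suc k))
           + β q (u (suc k) Data.List.++ 𝐛 ∷ v (n ∸ suc k))))
    * finv n

-- Coefficientwise the claim reduces, for i, j ≥ 1 and words u, v of
-- degrees i-1, j-1, to
--     β_q(u a v) + β_q(u b v) = [i+j choose i]_q β_q(u) β_q(v),
-- together with [i+j choose i]_q [i]! [j]! = [i+j]!.
-- For the β identity, cut a permutation σ ∈ 𝔖_{i+j} after position i: σ lies
-- in the class uav or ubv exactly when its two standardised halves lie in the
-- classes u and v (the letter at the cut is free), and inv σ is the sum of the
-- inversions of the halves and the cross inversions between them.  Summing
-- q^{cross} over the ways to distribute values between the halves gives the
-- q-binomial; this "shuffle decomposition" is proved by induction on the size,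
-- following how `perms` builds 𝔖_{n+1} by inserting n+1 into each σ ∈ 𝔖_n.
module Submission where

open import Defs
open import Level using (Level)
open import Data.Nat using (ℕ; _≤_; _∸_)
open import Data.List using (length)
open import Relation.Binary.PropositionalEquality using (_≡_)
open import Algebra.Bundles using (CommutativeRing)
open import Data.Nat using (zero; suc)
import Data.Nat.Properties as NP
open import Data.List using (_++_; _∷_)
open import Function using (_∘_)
import Relation.Binary.PropositionalEquality as P
import Relation.Binary.Reasoning.Setoid as SetoidReasoning

module PermutationStatistics where

  open import Data.Nat using (ℕ; zero; suc; _+_; _≤_; _<_; _<ᵇ_; z≤n; s≤s; _<?_)
  open import Data.Nat.Properties
  open import Algebra.Properties.CommutativeSemigroup +-commutativeSemigroup using (x∙yz≈y∙xz)
  open import Data.Bool using (Bool; true; false; if_then_else_; T)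
  open import Data.Unit using (tt)
  open import Data.Empty using (⊥-elim)
  open import Data.List using (List; []; _∷_; length; map; _++_; take; drop)
  open import Data.List.Properties using (map-∘; map-cong; map-cong-local; take-all; drop-all)
  open import Data.List.Relation.Unary.All as All using (All; []; _∷_)
  import Data.List.Relation.Unary.All.Properties as AllP
  open import Data.List.Membership.Propositional using (_∈_)
  open import Data.List.Relation.Unary.Any using (here; there)
  open import Data.Product using (Σ; _,_; _×_)
  open import Relation.Nullary using (yes; no)
  open import Relation.Binary.PropositionalEquality

  bit : Bool → ℕ
  bit b = if b then 1 else 0

  <⇒<ᵇ≡true : ∀ {x y} → x < y → (x <ᵇ y) ≡ true
  <⇒<ᵇ≡true {x} {y} x<y with x <ᵇ y | <⇒<ᵇ x<y
  ... | true | _ = refl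

  ≤⇒<ᵇ≡false : ∀ {x y} → y ≤ x → (x <ᵇ y) ≡ false
  ≤⇒<ᵇ≡false {x} {y} y≤x with x <ᵇ y in eq
  ... | false = refl
  ... | true  = ⊥-elim (<⇒≱ (<ᵇ⇒< x y (subst T (sym eq) tt)) y≤x)

  T-ext : ∀ {b c : Bool} → (T b → T c) → (T c → T b) → b ≡ c
  T-ext {false} {false} _ _ = refl
  T-ext {false} {true}  _ g = ⊥-elim (g tt)
  T-ext {true}  {false} f _ = ⊥-elim (f tt)
  T-ext {true}  {true}  _ _ = refl

  -- Standardisation.  `countGreater x ys` is weakly monotone in x, and strictly
  -- so across an element of ys; hence  rank a x = 1 + #{y ∈ a : y < x}  compares
  -- elements of a exactly as they compare themselves, and  std a = map (rank a) a
  -- is the permutation of {1..|a|} with the same relative order as a.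

  bit-mono : ∀ z {x y} → x ≤ y → bit (z <ᵇ x) ≤ bit (z <ᵇ y)
  bit-mono z {x} {y} x≤y with z <ᵇ x in eq
  ... | false = z≤n
  ... | true rewrite <⇒<ᵇ≡true (<-≤-trans (<ᵇ⇒< z x (subst T (sym eq) tt)) x≤y) = ≤-refl

  countGreater-mono : ∀ a {x y} → x ≤ y → countGreater x a ≤ countGreater y a
  countGreater-mono []       x≤y = z≤n
  countGreater-mono (z ∷ zs) x≤y = +-mono-≤ (bit-mono z x≤y) (countGreater-mono zs x≤y)

  countGreater-strict : ∀ a {x y} → x ∈ a → x < y → countGreater x a < countGreater y a
  countGreater-strict (z ∷ zs) {x} (here refl) x<y
    rewrite ≤⇒<ᵇ≡false (≤-refl {x}) | <⇒<ᵇ≡true x<y = s≤s (countGreater-mono zs (<⇒≤ x<y))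
  countGreater-strict (z ∷ zs) (there x∈zs) x<y =
    +-mono-≤-< (bit-mono z (<⇒≤ x<y)) (countGreater-strict zs x∈zs x<y)

  rank : List ℕ → ℕ → ℕ
  rank a x = suc (countGreater x a)

  std : List ℕ → List ℕ
  std a = map (rank a) a

  OrderPreservingOn : (ℕ → ℕ) → List ℕ → Set
  OrderPreservingOn h τ = ∀ {x} → x ∈ τ → ∀ y → (h x <ᵇ h y) ≡ (x <ᵇ y)

  rank-orderPreserving : ∀ a → OrderPreservingOn (rank a) a
  rank-orderPreserving a {x} x∈a y = T-ext to from
    where
    to : T (countGreater x a <ᵇ countGreater y a) → T (x <ᵇ y)
    to t with x <? y
    ... | yes x<y = <⇒<ᵇ x<y
    ... | no  x≮y = ⊥-elim (<⇒≱ (<ᵇ⇒< _ _ t) (countGreater-mono a (≮⇒≥ x≮y)))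
    from : T (x <ᵇ y) → T (countGreater x a <ᵇ countGreater y a)
    from t = <⇒<ᵇ (countGreater-strict a x∈a (<ᵇ⇒< x y t))

  countGreater-map : ∀ h x ys → (∀ {y} → y ∈ ys → (h y <ᵇ h x) ≡ (y <ᵇ x)) →
                     countGreater (h x) (map h ys) ≡ countGreater x ys
  countGreater-map h x []       _  = refl
  countGreater-map h x (y ∷ ys) hp rewrite hp (here refl) =
    cong (bit (y <ᵇ x) +_) (countGreater-map h x ys (λ y∈ys → hp (there y∈ys)))

  inv-map : ∀ h τ → OrderPreservingOn h τ → inv (map h τ) ≡ inv τ
  inv-map h []       _  = refl
  inv-map h (x ∷ xs) hp = cong₂ _+_ (countGreater-map h x xs (λ y∈xs → hp (there y∈xs) x))
                                    (inv-map h xs (λ y∈xs → hp (there y∈xs)))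

  descWord-map : ∀ h τ → OrderPreservingOn h τ → descWord (map h τ) ≡ descWord τ
  descWord-map h []           _  = refl
  descWord-map h (x ∷ [])     _  = refl
  descWord-map h (x ∷ y ∷ ys) hp =
    cong₂ _∷_ (cong (λ b → if b then 𝐚 else 𝐛) (hp (here refl) y))
              (descWord-map h (y ∷ ys) (λ z∈ → hp (there z∈)))

  inv-std : ∀ a → inv (std a) ≡ inv a
  inv-std a = inv-map (rank a) a (rank-orderPreserving a)

  descWord-std : ∀ a → descWord (std a) ≡ descWord a
  descWord-std a = descWord-map (rank a) a (rank-orderPreserving a)

  countGreater-insertions : ∀ n a → All (λ ρ → ∀ x → countGreater x ρ ≡ bit (n <ᵇ x) + countGreater x a)
                                        (insertions n a)
  countGreater-insertions n []       = (λ _ → refl) ∷ []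
  countGreater-insertions n (y ∷ ys) =
    (λ _ → refl) ∷ AllP.map⁺ {f = y ∷_} (All.map (λ {ρ} → cons {ρ}) (countGreater-insertions n ys))
    where
    cons : ∀ {ρ} → (∀ x → countGreater x ρ ≡ bit (n <ᵇ x) + countGreater x ys) →
           ∀ x → countGreater x (y ∷ ρ) ≡ bit (n <ᵇ x) + countGreater x (y ∷ ys)
    cons hρ x rewrite hρ x = x∙yz≈y∙xz (bit (y <ᵇ x)) (bit (n <ᵇ x)) (countGreater x ys)

  countGreater-above : ∀ n a → All (_< n) a → countGreater n a ≡ length a
  countGreater-above n []       []         = refl
  countGreater-above n (y ∷ ys) (y<n ∷ ps) rewrite <⇒<ᵇ≡true y<n = cong suc (countGreater-above n ys ps)

  map-insertions : ∀ h n a → map (map h) (insertions n a) ≡ insertions (h n) (map h a)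
  map-insertions h n []       = refl
  map-insertions h n (y ∷ ys) = cong ((h n ∷ h y ∷ map h ys) ∷_) (begin
    map (map h) (map (y ∷_) (insertions n ys))   ≡⟨ map-∘ (insertions n ys) ⟨
    map (λ ρ → h y ∷ map h ρ) (insertions n ys)  ≡⟨ map-∘ (insertions n ys) ⟩
    map (h y ∷_) (map (map h) (insertions n ys)) ≡⟨ cong (map (h y ∷_)) (map-insertions h n ys) ⟩
    map (h y ∷_) (insertions (h n) (map h ys))   ∎)
    where open ≡-Reasoning

  std-insertions : ∀ n a → All (_< n) a → map std (insertions n a) ≡ insertions (suc (length a)) (std a)
  std-insertions n a a<n = begin
    map std (insertions n a)      ≡⟨ map-cong-local (All.map (λ hρ → map-cong (λ x → cong suc (hρ x)) _)
                                                             (countGreater-insertions n a)) ⟩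
    map (map H) (insertions n a)  ≡⟨ map-insertions H n a ⟩
    insertions (H n) (map H a)    ≡⟨ cong₂ insertions H-max H-on-a ⟩
    insertions (suc (length a)) (std a) ∎
    where
    open ≡-Reasoning
    H : ℕ → ℕ
    H x = suc (bit (n <ᵇ x) + countGreater x a)
    H-max : H n ≡ suc (length a)
    H-max rewrite ≤⇒<ᵇ≡false (≤-refl {n}) = cong suc (countGreater-above n a a<n)
    H-on-a : map H a ≡ std a
    H-on-a = map-cong-local (All.map (λ {x} x<n → cong (λ b → suc (bit b + countGreater x a))
                                                        (≤⇒<ᵇ≡false (<⇒≤ x<n))) a<n)

  cross : List ℕ → List ℕ → ℕ
  cross []      b = 0
  cross (x ∷ a) b = countGreater x b + cross a b

  countGreater-++ : ∀ x a b → countGreater x (a ++ b) ≡ countGreater x a + countGreater x b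
  countGreater-++ x []       b = refl
  countGreater-++ x (y ∷ ys) b =
    trans (cong (bit (y <ᵇ x) +_) (countGreater-++ x ys b)) (sym (+-assoc (bit (y <ᵇ x)) _ _))

  inv-++ : ∀ a b → inv (a ++ b) ≡ inv a + cross a b + inv b
  inv-++ []      b = refl
  inv-++ (x ∷ a) b rewrite countGreater-++ x a b | inv-++ a b =
    rearrange (countGreater x a) (countGreater x b) (inv a) (cross a b) (inv b)
    where
    open import Data.Nat.Tactic.RingSolver using (solve-∀)
    rearrange : ∀ p q r s t → (p + q) + ((r + s) + t) ≡ ((p + r) + (q + s)) + t
    rearrange = solve-∀

  cross-insertionsˡ : ∀ n a b → All (λ α → cross α b ≡ countGreater n b + cross a b) (insertions n a)
  cross-insertionsˡ n []       b = refl ∷ []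
  cross-insertionsˡ n (y ∷ ys) b =
    refl ∷ AllP.map⁺ {f = y ∷_}
      (All.map (λ h → trans (cong (countGreater y b +_) h)
                            (x∙yz≈y∙xz (countGreater y b) (countGreater n b) (cross ys b)))
               (cross-insertionsˡ n ys b))

  cross-insertionsʳ : ∀ n a b → All (_< n) a → All (λ β → cross a β ≡ cross a b) (insertions n b)
  cross-insertionsʳ n a b a<n = All.map (λ hβ → unchanged a a<n hβ) (countGreater-insertions n b)
    where
    unchanged : ∀ a′ {β} → All (_< n) a′ → (∀ x → countGreater x β ≡ bit (n <ᵇ x) + countGreater x b) →
                cross a′ β ≡ cross a′ b
    unchanged []       []         _  = refl
    unchanged (x ∷ a′) (x<n ∷ ps) hβ rewrite hβ x | ≤⇒<ᵇ≡false (<⇒≤ x<n) =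
      cong (countGreater x b +_) (unchanged a′ ps hβ)

  insertions-split : ∀ {a} {A : Set a} (Φ : List ℕ → List ℕ → A) n i σ → suc i ≤ length σ →
    map (λ ρ → Φ (take (suc i) ρ) (drop (suc i) ρ)) (insertions n σ)
    ≡ map (λ α → Φ α (drop i σ)) (insertions n (take i σ))
      ++ map (λ β → Φ (take (suc i) σ) β) (insertions n (drop (suc i) σ))
  insertions-split Φ n zero (y ∷ ys) _ = cong (Φ (n ∷ []) (y ∷ ys) ∷_) (sym (map-∘ (insertions n ys)))
  insertions-split {A = A} Φ n (suc i) (y ∷ ys) (s≤s i<|ys|) =
    cong (Φ (n ∷ y ∷ take i ys) (drop i ys) ∷_) (begin
      map (λ ρ → Φ (take (suc (suc i)) ρ) (drop (suc (suc i)) ρ)) (map (y ∷_) (insertions n ys))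
        ≡⟨ map-∘ (insertions n ys) ⟨
      map (λ ρ → Φ (y ∷ take (suc i) ρ) (drop (suc i) ρ)) (insertions n ys)
        ≡⟨ insertions-split (λ a b → Φ (y ∷ a) b) n i ys i<|ys| ⟩
      map (λ α → Φ (y ∷ α) (drop i ys)) (insertions n (take i ys)) ++ rest
        ≡⟨ cong (_++ rest) (map-∘ (insertions n (take i ys))) ⟩
      map (λ α → Φ α (drop i ys)) (map (y ∷_) (insertions n (take i ys))) ++ rest ∎)
    where
    open ≡-Reasoning
    rest : List A
    rest = map (λ β → Φ (y ∷ take (suc i) ys) β) (insertions n (drop (suc i) ys))

  length-insertions : ∀ n a → All (λ ρ → length ρ ≡ suc (length a)) (insertions n a)
  length-insertions n []       = refl ∷ []
  length-insertions n (y ∷ ys) = refl ∷ AllP.map⁺ {f = y ∷_} (All.map (cong suc) (length-insertions n ys))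

  All-insertions : ∀ {P : ℕ → Set} n a → P n → All P a → All (All P) (insertions n a)
  All-insertions n []       pn []         = (pn ∷ []) ∷ []
  All-insertions n (y ∷ ys) pn (py ∷ pys) =
    (pn ∷ py ∷ pys) ∷ AllP.map⁺ {f = y ∷_} (All.map (py ∷_) (All-insertions n ys pn pys))

  PermShape : ℕ → List ℕ → Set
  PermShape n σ = length σ ≡ n × All (_< suc n) σ

  perms-shape : ∀ n → All (PermShape n) (perms n)
  perms-shape zero    = (refl , []) ∷ []
  perms-shape (suc n) = AllP.concat⁺ (AllP.map⁺ (All.map insert (perms-shape n)))
    where
    insert : ∀ {σ} → PermShape n σ → All (PermShape (suc n)) (insertions (suc n) σ)
    insert {σ} (|σ| , σ≤n) =
      All.zip (All.map (λ e → trans e (cong suc |σ|)) (length-insertions (suc n) σ) ,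
               All-insertions (suc n) σ ≤-refl (All.map m<n⇒m<1+n σ≤n))

  descWord-++ : ∀ x a y b → Σ Letter λ l → descWord ((x ∷ a) ++ (y ∷ b)) ≡ descWord (x ∷ a) ++ l ∷ descWord (y ∷ b)
  descWord-++ x []      y b = _ , refl
  descWord-++ x (z ∷ a) y b with descWord-++ z a y b
  ... | l , e = l , cong (_ ∷_) e

  length-descWord : ∀ x a → length (descWord (x ∷ a)) ≡ length a
  length-descWord x []      = refl
  length-descWord x (y ∷ a) = cong suc (length-descWord y a)

  cut-at-end : ∀ {a} {A : Set a} (F : List ℕ → List ℕ → A) k (ρ : List ℕ) → length ρ ≡ k →
               F (take k ρ) (drop k ρ) ≡ F ρ []
  cut-at-end F k ρ |ρ| = cong₂ F (take-all k ρ (≤-reflexive |ρ|)) (drop-all k ρ (≤-reflexive |ρ|))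

  length-take-+ : ∀ i j (σ : List ℕ) → length σ ≡ i + j → length (take i σ) ≡ i
  length-take-+ zero    j σ       _ = refl
  length-take-+ (suc i) j (x ∷ σ) e = cong suc (length-take-+ i j σ (suc-injective e))

  length-drop-+ : ∀ i j (σ : List ℕ) → length σ ≡ i + j → length (drop i σ) ≡ j
  length-drop-+ zero    j σ       e = e
  length-drop-+ (suc i) j (x ∷ σ) e = length-drop-+ i j σ (suc-injective e)

module QAnalogue {ℓc ℓ : Level} (R : CommutativeRing ℓc ℓ) where

  open PermutationStatistics
  open import Data.Nat as N using (ℕ; zero; suc; _∸_; z≤n; s≤s)
  import Data.Nat.Properties as NP
  open import Data.Bool using (Bool; true; false; if_then_else_)
  open import Data.List using (List; []; _∷_; length; map; _++_; take; drop; concatMap; filter)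
  import Data.List.Properties as LP
  open import Data.List.Relation.Unary.All using (All; []; _∷_)
  import Data.List.Relation.Unary.All.Properties as AllP
  open import Data.Product using (Σ; _,_; _×_; proj₁; proj₂)
  open import Relation.Nullary using (yes; no; does; Dec)
  open import Function using (case_of_)
  open import Relation.Nullary.Decidable using (dec-true; dec-false)
  import Relation.Binary.PropositionalEquality as P
  open P using (_≡_)
  open CommutativeRing R hiding (zero)
  open Series R
  open import Relation.Binary.Reasoning.Setoid setoid
  open import Algebra.Solver.Ring.NaturalCoefficients.Default commutativeSemiring
    using (solve; _:=_; _:+_; _:*_; con)

  ΣL : ∀ {A : Set} → List A → (A → Carrier) → Carrier
  ΣL xs f = sumL (map f xs)

  sumL-++ : ∀ xs ys → sumL (xs ++ ys) ≈ sumL xs + sumL ys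
  sumL-++ []       ys = sym (+-identityˡ _)
  sumL-++ (x ∷ xs) ys = trans (+-congˡ (sumL-++ xs ys)) (sym (+-assoc _ _ _))

  ΣL-++ : ∀ {A : Set} (xs ys : List A) f → ΣL (xs ++ ys) f ≈ ΣL xs f + ΣL ys f
  ΣL-++ xs ys f = trans (reflexive (P.cong sumL (LP.map-++ f xs ys))) (sumL-++ (map f xs) (map f ys))

  ΣL-concatMap : ∀ {A B : Set} (g : A → List B) xs F → ΣL (concatMap g xs) F ≈ ΣL xs (λ x → ΣL (g x) F)
  ΣL-concatMap g []       F = refl
  ΣL-concatMap g (x ∷ xs) F = trans (ΣL-++ (g x) (concatMap g xs) F) (+-congˡ (ΣL-concatMap g xs F))

  ΣL-congAll : ∀ {A : Set} {P : A → Set} (xs : List A) {F G : A → Carrier} →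
               All P xs → (∀ {x} → P x → F x ≈ G x) → ΣL xs F ≈ ΣL xs G
  ΣL-congAll []       []       _  = refl
  ΣL-congAll (x ∷ xs) (p ∷ ps) eq = +-cong (eq p) (ΣL-congAll xs ps eq)

  ΣL-*ˡ : ∀ {A : Set} (xs : List A) c F → ΣL xs (λ x → c * F x) ≈ c * ΣL xs F
  ΣL-*ˡ []       c F = sym (zeroʳ c)
  ΣL-*ˡ (x ∷ xs) c F = trans (+-congˡ (ΣL-*ˡ xs c F)) (sym (distribˡ c _ _))

  ΣL-*ʳ : ∀ {A : Set} (xs : List A) c F → ΣL xs (λ x → F x * c) ≈ ΣL xs F * c
  ΣL-*ʳ []       c F = sym (zeroˡ c)
  ΣL-*ʳ (x ∷ xs) c F = trans (+-congˡ (ΣL-*ʳ xs c F)) (sym (distribʳ c _ _))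

  ΣL-+ : ∀ {A : Set} (xs : List A) F G → ΣL xs (λ x → F x + G x) ≈ ΣL xs F + ΣL xs G
  ΣL-+ []       F G = sym (+-identityˡ 0#)
  ΣL-+ (x ∷ xs) F G = trans (+-congˡ (ΣL-+ xs F G))
    (solve 4 (λ a b c d → (a :+ b) :+ (c :+ d) := (a :+ c) :+ (b :+ d)) refl _ _ _ _)

  ΣL-map : ∀ {A B : Set} (g : A → B) xs F → ΣL (map g xs) F ≡ ΣL xs (λ x → F (g x))
  ΣL-map g xs F = P.cong sumL (P.sym (LP.map-∘ xs))

  bitR : Bool → Carrier
  bitR b = if b then 1# else 0#

  ΣL-filter : ∀ {A : Set} {P : A → Set} (P? : ∀ x → Dec (P x)) xs h →
              ΣL (filter P? xs) h ≈ ΣL xs (λ x → bitR (does (P? x)) * h x)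
  ΣL-filter P? []       h = refl
  ΣL-filter P? (x ∷ xs) h with does (P? x)
  ... | true  = +-cong (sym (*-identityˡ _)) (ΣL-filter P? xs h)
  ... | false = trans (ΣL-filter P? xs h) (trans (sym (+-identityˡ _)) (+-congʳ (sym (zeroˡ _))))

  pow-+ : ∀ x a b → pow x (a N.+ b) ≈ pow x a * pow x b
  pow-+ x zero    b = sym (*-identityˡ _)
  pow-+ x (suc a) b = trans (*-congˡ (pow-+ x a b)) (sym (*-assoc _ _ _))

  sumRange-shift : ∀ M h → sumRange (suc M) h ≈ h 0 + sumRange M (λ k → h (suc k))
  sumRange-shift zero    h = +-comm _ _
  sumRange-shift (suc M) h = trans (+-congʳ (sumRange-shift M h)) (+-assoc _ _ _)

  sumRange-cong< : ∀ M {F G : ℕ → Carrier} → (∀ k → k N.< M → F k ≈ G k) → sumRange M F ≈ sumRange M G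
  sumRange-cong< zero    _  = refl
  sumRange-cong< (suc M) eq = +-cong (sumRange-cong< M (λ k k<M → eq k (NP.m<n⇒m<1+n k<M))) (eq M NP.≤-refl)

  sumRange-*ʳ : ∀ M F x → sumRange M F * x ≈ sumRange M (λ k → F k * x)
  sumRange-*ʳ zero    F x = zeroˡ x
  sumRange-*ʳ (suc M) F x = trans (distribʳ x _ _) (+-congʳ (sumRange-*ʳ M F x))

  cauchy-interior : ∀ A B → A 0 ≈ 0# → B 0 ≈ 0# → ∀ n →
                    cauchy A B (suc n) ≈ sumRange n (λ k → A (suc k) * B (n ∸ k))
  cauchy-interior A B A0≈0 B0≈0 n = begin
    sumRange (suc n) h + h (suc n)              ≈⟨ +-cong (sumRange-shift n h) last≈0 ⟩
    (h 0 + sumRange n (λ k → h (suc k))) + 0#   ≈⟨ +-identityʳ _ ⟩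
    h 0 + sumRange n (λ k → h (suc k))          ≈⟨ +-congʳ (trans (*-congʳ A0≈0) (zeroˡ _)) ⟩
    0# + sumRange n (λ k → h (suc k))           ≈⟨ +-identityˡ _ ⟩
    sumRange n (λ k → A (suc k) * B (n ∸ k))    ∎
    where
    h : ℕ → Carrier
    h k = A k * B (suc n ∸ k)
    last≈0 : h (suc n) ≈ 0#
    last≈0 = trans (*-congˡ (trans (reflexive (P.cong B (NP.n∸n≡0 n))) B0≈0)) (zeroʳ _)

  module _ (q : Carrier) where

    qint-+ : ∀ a b → qint q (a N.+ b) ≈ qint q b + pow q b * qint q a
    qint-+ zero    b = sym (trans (+-congˡ (zeroʳ _)) (+-identityʳ _))
    qint-+ (suc a) b = begin
      qint q (a N.+ b) + pow q (a N.+ b)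
        ≈⟨ +-cong (qint-+ a b) (trans (pow-+ q a b) (*-comm _ _)) ⟩
      (qint q b + pow q b * qint q a) + pow q b * pow q a
        ≈⟨ solve 4 (λ x y z w → (x :+ y :* z) :+ y :* w := x :+ y :* (z :+ w))
                   refl (qint q b) (pow q b) (qint q a) (pow q a) ⟩
      qint q b + pow q b * (qint q a + pow q a) ∎

    -- The q-binomial coefficient  qbinom i j = [i+j choose i]_q, by the
    -- q-Pascal recurrence that the shuffle decomposition below produces.
    qbinom : ℕ → ℕ → Carrier
    qbinom zero    j       = 1#
    qbinom (suc i) zero    = 1#
    qbinom (suc i) (suc j) = pow q (suc j) * qbinom i (suc j) + qbinom (suc i) j

    qbinom-n0 : ∀ i → qbinom i 0 ≈ 1#
    qbinom-n0 zero    = refl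
    qbinom-n0 (suc i) = refl

    qbinom-fact : ∀ i j → qbinom i j * (qfact q i * qfact q j) ≈ qfact q (i N.+ j)
    qbinom-fact zero j = solve 1 (λ x → con 1 :* (con 1 :* x) := x) refl (qfact q j)
    qbinom-fact (suc i) zero rewrite NP.+-identityʳ i =
      solve 1 (λ x → con 1 :* (x :* con 1) := x) refl (qfact q (suc i))
    qbinom-fact (suc i) (suc j) = begin
      (K * X1 + X2) * ((Fi * Qi) * (Fj * Qj))
        ≈⟨ solve 7 (λ k x1 x2 fi qi fj qj → (k :* x1 :+ x2) :* ((fi :* qi) :* (fj :* qj))
                      := (k :* qi) :* (x1 :* (fi :* (fj :* qj))) :+ qj :* (x2 :* ((fi :* qi) :* fj)))
                   refl K X1 X2 Fi Qi Fj Qj ⟩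
      (K * Qi) * (X1 * (Fi * (Fj * Qj))) + Qj * (X2 * ((Fi * Qi) * Fj))
        ≈⟨ +-cong (*-congˡ (qbinom-fact i (suc j))) (*-congˡ (qbinom-fact (suc i) j)) ⟩
      (K * Qi) * qfact q (i N.+ suc j) + Qj * qfact q (suc i N.+ j)
        ≡⟨ P.cong (λ t → (K * Qi) * F + Qj * qfact q t) (P.sym (NP.+-suc i j)) ⟩
      (K * Qi) * F + Qj * F
        ≈⟨ solve 4 (λ k qi qj f → (k :* qi) :* f :+ qj :* f := f :* (qj :+ k :* qi)) refl K Qi Qj F ⟩
      F * (Qj + K * Qi)
        ≈⟨ *-congˡ (sym (qint-+ (suc i) (suc j))) ⟩
      F * qint q (suc i N.+ suc j) ∎
      where
      K X1 X2 Fi Fj Qi Qj F : Carrier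
      K  = pow q (suc j)
      X1 = qbinom i (suc j)
      X2 = qbinom (suc i) j
      Fi = qfact q i
      Fj = qfact q j
      Qi = qint q (suc i)
      Qj = qint q (suc j)
      F  = qfact q (i N.+ suc j)

    qbinom-finv : (finv : ℕ → Carrier) → (∀ n → qfact q n * finv n ≈ 1#) →
                  ∀ i j → qbinom i j * finv (i N.+ j) ≈ finv i * finv j
    qbinom-finv finv inverse i j = begin
      qbinom i j * finv (i N.+ j)
        ≈⟨ sym (trans (*-congˡ (*-cong (inverse i) (inverse j)))
                      (trans (*-congˡ (*-identityˡ 1#)) (*-identityʳ _))) ⟩
      (qbinom i j * finv (i N.+ j)) * ((qfact q i * finv i) * (qfact q j * finv j))
        ≈⟨ solve 6 (λ x fn a fi b fj → (x :* fn) :* ((a :* fi) :* (b :* fj))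
                                      := ((x :* (a :* b)) :* fn) :* (fi :* fj))
                   refl (qbinom i j) (finv (i N.+ j)) (qfact q i) (finv i) (qfact q j) (finv j) ⟩
      ((qbinom i j * (qfact q i * qfact q j)) * finv (i N.+ j)) * (finv i * finv j)
        ≈⟨ *-congʳ (*-congʳ (qbinom-fact i j)) ⟩
      (qfact q (i N.+ j) * finv (i N.+ j)) * (finv i * finv j)
        ≈⟨ *-congʳ (inverse (i N.+ j)) ⟩
      1# * (finv i * finv j)
        ≈⟨ *-identityˡ _ ⟩
      finv i * finv j ∎

    -- Cut a permutation σ of [n] after position i and
    -- standardise both halves;  splitTerm f g a b  weighs the cut (a | b) by
    -- q^{cross a b} f(std a) g(std b).  Summing over σ ∈ 𝔖_{i+j} gives
    -- [i+j choose i]_q (Σ_{𝔖_i} f)(Σ_{𝔖_j} g): the cut is a bijection onto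
    -- (subset, 𝔖_i, 𝔖_j) and the subset contributes its q-counted cross inversions.
    splitTerm : (List ℕ → Carrier) → (List ℕ → Carrier) → List ℕ → List ℕ → Carrier
    splitTerm f g a b = pow q (cross a b) * (f (std a) * g (std b))

    Σperm : (List ℕ → Carrier) → ℕ → Carrier
    Σperm f n = ΣL (perms n) f

    insertSum : (List ℕ → Carrier) → ℕ → List ℕ → Carrier
    insertSum f k τ = ΣL (insertions k τ) f

    Σperm-insertSum : ∀ f m → Σperm (insertSum f (suc m)) m ≈ Σperm f (suc m)
    Σperm-insertSum f m = sym (ΣL-concatMap (insertions (suc m)) (perms m) f)

    insertSum-std : ∀ n a f → All (N._< n) a →
                    ΣL (insertions n a) (λ α → f (std α)) ≈ insertSum f (suc (length a)) (std a)
    insertSum-std n a f a<n = reflexive (P.trans (P.sym (ΣL-map std (insertions n a) f))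
                                                 (P.cong (λ l → ΣL l f) (std-insertions n a a<n)))

    -- Inserting a new maximum n into the left block: it lies above all of b,
    -- which costs a factor q^{|b|}.
    insertMax-left : ∀ n a b f g → All (N._< n) a → All (N._< n) b →
      ΣL (insertions n a) (λ α → splitTerm f g α b)
      ≈ pow q (length b) * splitTerm (insertSum f (suc (length a))) g a b
    insertMax-left n a b f g a<n b<n = begin
      ΣL (insertions n a) (λ α → splitTerm f g α b)
        ≈⟨ ΣL-congAll (insertions n a) (cross-insertionsˡ n a b) (λ {α} e → *-congʳ (crossPow α e)) ⟩
      ΣL (insertions n a) (λ α → (K * P0) * (f (std α) * G))
        ≈⟨ ΣL-*ˡ (insertions n a) (K * P0) _ ⟩
      (K * P0) * ΣL (insertions n a) (λ α → f (std α) * G)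
        ≈⟨ *-congˡ (ΣL-*ʳ (insertions n a) G _) ⟩
      (K * P0) * (ΣL (insertions n a) (λ α → f (std α)) * G)
        ≈⟨ *-congˡ (*-congʳ (insertSum-std n a f a<n)) ⟩
      (K * P0) * (insertSum f (suc (length a)) (std a) * G)
        ≈⟨ *-assoc _ _ _ ⟩
      K * splitTerm (insertSum f (suc (length a))) g a b ∎
      where
      K P0 G : Carrier
      K  = pow q (length b)
      P0 = pow q (cross a b)
      G  = g (std b)
      crossPow : ∀ α → cross α b ≡ countGreater n b N.+ cross a b → pow q (cross α b) ≈ K * P0
      crossPow α e = begin
        pow q (cross α b)                        ≡⟨ P.cong (pow q) e ⟩
        pow q (countGreater n b N.+ cross a b)   ≈⟨ pow-+ q (countGreater n b) (cross a b) ⟩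
        pow q (countGreater n b) * P0            ≡⟨ P.cong (λ k → pow q k * P0) (countGreater-above n b b<n) ⟩
        K * P0                                   ∎

    -- Inserting a new maximum n into the right block creates no cross inversion.
    insertMax-right : ∀ n a b f g → All (N._< n) a → All (N._< n) b →
      ΣL (insertions n b) (λ β → splitTerm f g a β) ≈ splitTerm f (insertSum g (suc (length b))) a b
    insertMax-right n a b f g a<n b<n = begin
      ΣL (insertions n b) (λ β → splitTerm f g a β)
        ≈⟨ ΣL-congAll (insertions n b) (cross-insertionsʳ n a b a<n) (λ e → *-congʳ (reflexive (P.cong (pow q) e))) ⟩
      ΣL (insertions n b) (λ β → P0 * (F * g (std β)))
        ≈⟨ ΣL-*ˡ (insertions n b) P0 _ ⟩
      P0 * ΣL (insertions n b) (λ β → F * g (std β))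
        ≈⟨ *-congˡ (ΣL-*ˡ (insertions n b) F _) ⟩
      P0 * (F * ΣL (insertions n b) (λ β → g (std β)))
        ≈⟨ *-congˡ (*-congˡ (insertSum-std n b g b<n)) ⟩
      splitTerm f (insertSum g (suc (length b))) a b ∎
      where
      P0 F : Carrier
      P0 = pow q (cross a b)
      F  = f (std a)

    -- Inserting m+1 into σ0 ∈ 𝔖_m and cutting after position i+1 when both
    -- sides stay nonempty: the new maximum went either left or right.
    insertMax-cut : ∀ m i j f g σ0 → length σ0 ≡ i N.+ suc j → All (N._< suc m) σ0 →
      ΣL (insertions (suc m) σ0) (λ ρ → splitTerm f g (take (suc i) ρ) (drop (suc i) ρ))
      ≈ pow q (suc j) * splitTerm (insertSum f (suc i)) g (take i σ0) (drop i σ0)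
        + splitTerm f (insertSum g (suc j)) (take (suc i) σ0) (drop (suc i) σ0)
    insertMax-cut m i j f g σ0 |σ0| σ0<n = begin
      ΣL (insertions n σ0) (λ ρ → splitTerm f g (take (suc i) ρ) (drop (suc i) ρ))
        ≡⟨ P.cong sumL (insertions-split (splitTerm f g) n i σ0 cut≤) ⟩
      sumL (map (λ α → splitTerm f g α b0) (insertions n a0) ++ map (λ β → splitTerm f g a1 β) (insertions n b1))
        ≈⟨ sumL-++ (map (λ α → splitTerm f g α b0) (insertions n a0)) (map (λ β → splitTerm f g a1 β) (insertions n b1)) ⟩
      ΣL (insertions n a0) (λ α → splitTerm f g α b0) + ΣL (insertions n b1) (λ β → splitTerm f g a1 β)
        ≈⟨ +-cong (insertMax-left n a0 b0 f g (AllP.take⁺ i σ0<n) (AllP.drop⁺ i σ0<n))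
                  (insertMax-right n a1 b1 f g (AllP.take⁺ (suc i) σ0<n) (AllP.drop⁺ (suc i) σ0<n)) ⟩
      pow q (length b0) * splitTerm (insertSum f (suc (length a0))) g a0 b0
        + splitTerm f (insertSum g (suc (length b1))) a1 b1
        ≡⟨ P.cong₂ _+_ (P.cong₂ (λ k l → pow q l * splitTerm (insertSum f (suc k)) g a0 b0)
                                (length-take-+ i (suc j) σ0 |σ0|) (length-drop-+ i (suc j) σ0 |σ0|))
                       (P.cong (λ l → splitTerm f (insertSum g (suc l)) a1 b1) (length-drop-+ (suc i) j σ0 |σ0|′)) ⟩
      pow q (suc j) * splitTerm (insertSum f (suc i)) g a0 b0 + splitTerm f (insertSum g (suc j)) a1 b1 ∎
      where
      n : ℕ
      n = suc m
      a0 b0 a1 b1 : List ℕ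
      a0 = take i σ0
      b0 = drop i σ0
      a1 = take (suc i) σ0
      b1 = drop (suc i) σ0
      |σ0|′ : length σ0 ≡ suc i N.+ j
      |σ0|′ = P.trans |σ0| (NP.+-suc i j)
      cut≤ : suc i N.≤ length σ0
      cut≤ = P.subst (suc i N.≤_) (P.sym |σ0|′) (NP.m≤m+n (suc i) j)

    shuffle-decomposition : ∀ n i j → i N.+ j ≡ n → ∀ f g →
      ΣL (perms n) (λ σ → splitTerm f g (take i σ) (drop i σ)) ≈ qbinom i j * (Σperm f i * Σperm g j)
    shuffle-decomposition zero zero zero P.refl f g =
      solve 2 (λ x y → con 1 :* (x :* y) :+ con 0 := con 1 :* ((x :+ con 0) :* (y :+ con 0))) refl (f []) (g [])
    shuffle-decomposition (suc m) zero .(suc m) P.refl f g = begin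
      ΣL (perms (suc m)) (λ σ → splitTerm f g [] σ)
        ≈⟨ ΣL-concatMap (insertions (suc m)) (perms m) _ ⟩
      ΣL (perms m) (λ σ0 → ΣL (insertions (suc m) σ0) (λ ρ → splitTerm f g [] ρ))
        ≈⟨ ΣL-congAll (perms m) (perms-shape m) insertRight ⟩
      ΣL (perms m) (λ σ0 → splitTerm f (insertSum g (suc m)) [] σ0)
        ≈⟨ shuffle-decomposition m zero m P.refl f (insertSum g (suc m)) ⟩
      1# * (Σperm f 0 * Σperm (insertSum g (suc m)) m)
        ≈⟨ *-congˡ (*-congˡ (Σperm-insertSum g m)) ⟩
      1# * (Σperm f 0 * Σperm g (suc m)) ∎
      where
      insertRight : ∀ {σ0} → PermShape m σ0 →
        ΣL (insertions (suc m) σ0) (λ ρ → splitTerm f g [] ρ) ≈ splitTerm f (insertSum g (suc m)) [] σ0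
      insertRight {σ0} (|σ0| , σ0≤m) =
        trans (insertMax-right (suc m) [] σ0 f g [] σ0≤m)
              (reflexive (P.cong (λ k → splitTerm f (insertSum g (suc k)) [] σ0) |σ0|))
    shuffle-decomposition (suc m) (suc i) zero i+0≡m f g
      with P.trans (P.sym (NP.+-identityʳ i)) (NP.suc-injective i+0≡m)
    ... | P.refl = begin
      ΣL (perms (suc i)) (λ σ → splitTerm f g (take (suc i) σ) (drop (suc i) σ))
        ≈⟨ ΣL-concatMap (insertions (suc i)) (perms i) _ ⟩
      ΣL (perms i) (λ σ0 → ΣL (insertions (suc i) σ0) (λ ρ → splitTerm f g (take (suc i) ρ) (drop (suc i) ρ)))
        ≈⟨ ΣL-congAll (perms i) (perms-shape i) insertLeft ⟩
      ΣL (perms i) (λ σ0 → splitTerm (insertSum f (suc i)) g (take i σ0) (drop i σ0))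
        ≈⟨ shuffle-decomposition i i zero (NP.+-identityʳ i) (insertSum f (suc i)) g ⟩
      qbinom i 0 * (Σperm (insertSum f (suc i)) i * Σperm g 0)
        ≈⟨ *-cong (qbinom-n0 i) (*-congʳ (Σperm-insertSum f i)) ⟩
      1# * (Σperm f (suc i) * Σperm g 0) ∎
      where
      insertLeft : ∀ {σ0} → PermShape i σ0 →
        ΣL (insertions (suc i) σ0) (λ ρ → splitTerm f g (take (suc i) ρ) (drop (suc i) ρ))
        ≈ splitTerm (insertSum f (suc i)) g (take i σ0) (drop i σ0)
      insertLeft {σ0} (|σ0| , σ0≤i) = begin
        ΣL (insertions (suc i) σ0) (λ ρ → splitTerm f g (take (suc i) ρ) (drop (suc i) ρ))
          ≈⟨ ΣL-congAll (insertions (suc i) σ0) (length-insertions (suc i) σ0)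
               (λ {ρ} |ρ| → reflexive (cut-at-end (splitTerm f g) (suc i) ρ (P.trans |ρ| (P.cong suc |σ0|)))) ⟩
        ΣL (insertions (suc i) σ0) (λ ρ → splitTerm f g ρ [])
          ≈⟨ insertMax-left (suc i) σ0 [] f g σ0≤i [] ⟩
        1# * splitTerm (insertSum f (suc (length σ0))) g σ0 []
          ≈⟨ *-identityˡ _ ⟩
        splitTerm (insertSum f (suc (length σ0))) g σ0 []
          ≡⟨ P.cong (λ k → splitTerm (insertSum f (suc k)) g σ0 []) |σ0| ⟩
        splitTerm (insertSum f (suc i)) g σ0 []
          ≡⟨ cut-at-end (splitTerm (insertSum f (suc i)) g) i σ0 |σ0| ⟨
        splitTerm (insertSum f (suc i)) g (take i σ0) (drop i σ0) ∎
    shuffle-decomposition (suc m) (suc i) (suc j) i+j≡m f g = begin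
      ΣL (perms (suc m)) (λ σ → splitTerm f g (take (suc i) σ) (drop (suc i) σ))
        ≈⟨ ΣL-concatMap (insertions (suc m)) (perms m) _ ⟩
      ΣL (perms m) (λ σ0 → ΣL (insertions (suc m) σ0) (λ ρ → splitTerm f g (take (suc i) ρ) (drop (suc i) ρ)))
        ≈⟨ ΣL-congAll (perms m) (perms-shape m)
             (λ {σ0} (|σ0| , σ0≤m) → insertMax-cut m i j f g σ0 (P.trans |σ0| (P.sym e)) σ0≤m) ⟩
      ΣL (perms m) (λ σ0 → K * L σ0 + Rt σ0)
        ≈⟨ ΣL-+ (perms m) _ _ ⟩
      ΣL (perms m) (λ σ0 → K * L σ0) + ΣL (perms m) Rt
        ≈⟨ +-congʳ (ΣL-*ˡ (perms m) K L) ⟩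
      K * ΣL (perms m) L + ΣL (perms m) Rt
        ≈⟨ +-cong (*-congˡ (shuffle-decomposition m i (suc j) e (insertSum f (suc i)) g))
                  (shuffle-decomposition m (suc i) j e′ f (insertSum g (suc j))) ⟩
      K * (qbinom i (suc j) * (Σperm (insertSum f (suc i)) i * Σperm g (suc j)))
        + qbinom (suc i) j * (Σperm f (suc i) * Σperm (insertSum g (suc j)) j)
        ≈⟨ +-cong (*-congˡ (*-congˡ (*-congʳ (Σperm-insertSum f i)))) (*-congˡ (*-congˡ (Σperm-insertSum g j))) ⟩
      K * (qbinom i (suc j) * (Σperm f (suc i) * Σperm g (suc j))) + qbinom (suc i) j * (Σperm f (suc i) * Σperm g (suc j))
        ≈⟨ solve 4 (λ k a b x → k :* (a :* x) :+ b :* x := (k :* a :+ b) :* x) refl K _ _ _ ⟩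
      qbinom (suc i) (suc j) * (Σperm f (suc i) * Σperm g (suc j)) ∎
      where
      K : Carrier
      K = pow q (suc j)
      L Rt : List ℕ → Carrier
      L  σ0 = splitTerm (insertSum f (suc i)) g (take i σ0) (drop i σ0)
      Rt σ0 = splitTerm f (insertSum g (suc j)) (take (suc i) σ0) (drop (suc i) σ0)
      e : i N.+ suc j ≡ m
      e = NP.suc-injective i+j≡m
      e′ : suc i N.+ j ≡ m
      e′ = P.trans (P.sym (NP.+-suc i j)) e

    -- Over a cut of
    -- fixed position, the letter at the cut is unconstrained in  uav + ubv:
    -- the two classes together are exactly "left part has class u, right part class v".
    match : Word → Word → Carrier
    match d w = bitR (does (d ≟w w))

    ++-cancel-sameLength : ∀ (d w : Word) r s → length d ≡ length w → d ++ r ≡ w ++ s → d ≡ w × r ≡ s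
    ++-cancel-sameLength []      []      r s _ e = P.refl , e
    ++-cancel-sameLength (x ∷ d) (y ∷ w) r s l e with LP.∷-injective e
    ... | P.refl , e′ with ++-cancel-sameLength d w r s (NP.suc-injective l) e′
    ... | P.refl , e″ = P.refl , e″

    after-prefix : ∀ d {x y : Letter} {r s : Word} → d ++ x ∷ r ≡ d ++ y ∷ s → x ≡ y × r ≡ s
    after-prefix d e = LP.∷-injective (LP.++-cancelˡ d _ _ e)

    match-split : ∀ d1 l d2 w1 w2 → length d1 ≡ length w1 →
      match (d1 ++ l ∷ d2) (w1 ++ 𝐚 ∷ w2) + match (d1 ++ l ∷ d2) (w1 ++ 𝐛 ∷ w2) ≈ match d1 w1 * match d2 w2
    match-split d1 l d2 w1 w2 len with d1 ≟w w1
    ... | no d1≢w1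
      rewrite dec-false ((d1 ++ l ∷ d2) ≟w (w1 ++ 𝐚 ∷ w2)) (λ e → d1≢w1 (proj₁ (++-cancel-sameLength d1 w1 _ _ len e)))
            | dec-false ((d1 ++ l ∷ d2) ≟w (w1 ++ 𝐛 ∷ w2)) (λ e → d1≢w1 (proj₁ (++-cancel-sameLength d1 w1 _ _ len e)))
      = trans (+-identityˡ 0#) (sym (zeroˡ _))
    ... | yes P.refl with d2 ≟w w2
    ...   | no d2≢w2
      rewrite dec-false ((d1 ++ l ∷ d2) ≟w (d1 ++ 𝐚 ∷ w2)) (λ e → d2≢w2 (proj₂ (after-prefix d1 e)))
            | dec-false ((d1 ++ l ∷ d2) ≟w (d1 ++ 𝐛 ∷ w2)) (λ e → d2≢w2 (proj₂ (after-prefix d1 e)))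
      = trans (+-identityˡ 0#) (sym (zeroʳ _))
    match-split d1 𝐚 d2 w1 w2 len | yes P.refl | yes P.refl
      rewrite dec-true ((d1 ++ 𝐚 ∷ d2) ≟w (d1 ++ 𝐚 ∷ d2)) P.refl
            | dec-false ((d1 ++ 𝐚 ∷ d2) ≟w (d1 ++ 𝐛 ∷ d2)) (λ e → case proj₁ (after-prefix d1 e) of λ ())
      = trans (+-identityʳ 1#) (sym (*-identityˡ 1#))
    match-split d1 𝐛 d2 w1 w2 len | yes P.refl | yes P.refl
      rewrite dec-true ((d1 ++ 𝐛 ∷ d2) ≟w (d1 ++ 𝐛 ∷ d2)) P.refl
            | dec-false ((d1 ++ 𝐛 ∷ d2) ≟w (d1 ++ 𝐚 ∷ d2)) (λ e → case proj₁ (after-prefix d1 e) of λ ())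
      = trans (+-identityˡ 1#) (sym (*-identityˡ 1#))

    weight : Word → List ℕ → Carrier
    weight w τ = match (descWord τ) w * pow q (inv τ)

    β-as-sum : ∀ w M → suc (length w) ≡ M → β q w ≈ Σperm (weight w) M
    β-as-sum w .(suc (length w)) P.refl =
      ΣL-filter (λ σ → descWord σ ≟w w) (perms (suc (length w))) (λ σ → pow q (inv σ))

    -- For a cut (a | b) of lengths |u|+1 and |v|+1, the weights of a ++ b for
    -- uav and ubv together equal the cut's splitTerm for the weights of u and v:
    -- inversions split as inv a + cross + inv b, and std preserves inv and descWord.
    weight-split : ∀ u v a b → length a ≡ suc (length u) → length b ≡ suc (length v) →
      weight (u ++ 𝐚 ∷ v) (a ++ b) + weight (u ++ 𝐛 ∷ v) (a ++ b) ≈ splitTerm (weight u) (weight v) a b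
    weight-split u v (x ∷ a′) (y ∷ b′) |a| |b| = begin
      match D Wa * p + match D Wb * p
        ≈⟨ distribʳ p _ _ ⟨
      (match D Wa + match D Wb) * p
        ≡⟨ P.cong₂ (λ D′ k → (match D′ Wa + match D′ Wb) * pow q k) (proj₂ desc) (inv-++ a b) ⟩
      (match (da ++ l ∷ db) Wa + match (da ++ l ∷ db) Wb) * pow q (inv a N.+ cross a b N.+ inv b)
        ≈⟨ *-cong (match-split da l db u v |da|)
                  (trans (pow-+ q (inv a N.+ cross a b) (inv b)) (*-congʳ (pow-+ q (inv a) (cross a b)))) ⟩
      (match da u * match db v) * ((pow q (inv a) * pow q (cross a b)) * pow q (inv b))
        ≈⟨ solve 5 (λ A B C X Y → (A :* B) :* ((X :* C) :* Y) := C :* ((A :* X) :* (B :* Y)))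
                   refl (match da u) (match db v) (pow q (cross a b)) (pow q (inv a)) (pow q (inv b)) ⟩
      pow q (cross a b) * (weight u a * weight v b)
        ≡⟨ P.cong₂ (λ s t → pow q (cross a b) * (s * t)) (standardised u a) (standardised v b) ⟨
      splitTerm (weight u) (weight v) a b ∎
      where
      a b : List ℕ
      a = x ∷ a′
      b = y ∷ b′
      Wa Wb D da db : Word
      Wa = u ++ 𝐚 ∷ v
      Wb = u ++ 𝐛 ∷ v
      D  = descWord (a ++ b)
      da = descWord a
      db = descWord b
      p : Carrier
      p = pow q (inv (a ++ b))
      desc : Σ Letter (λ l → descWord (a ++ b) ≡ da ++ l ∷ db)
      desc = descWord-++ x a′ y b′
      l : Letter
      l = proj₁ desc
      |da| : length da ≡ length u
      |da| = P.trans (length-descWord x a′) (NP.suc-injective |a|)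
      standardised : ∀ w τ → weight w (std τ) ≡ weight w τ
      standardised w τ = P.cong₂ (λ d k → match d w * pow q k) (descWord-std τ) (inv-std τ)

    β-split : ∀ u v → β q (u ++ 𝐚 ∷ v) + β q (u ++ 𝐛 ∷ v)
                      ≈ qbinom (suc (length u)) (suc (length v)) * (β q u * β q v)
    β-split u v = begin
      β q (u ++ 𝐚 ∷ v) + β q (u ++ 𝐛 ∷ v)
        ≈⟨ +-cong (β-as-sum (u ++ 𝐚 ∷ v) M |uav|) (β-as-sum (u ++ 𝐛 ∷ v) M |uav|) ⟩
      Σperm (weight (u ++ 𝐚 ∷ v)) M + Σperm (weight (u ++ 𝐛 ∷ v)) M
        ≈⟨ ΣL-+ (perms M) _ _ ⟨
      ΣL (perms M) (λ σ → weight (u ++ 𝐚 ∷ v) σ + weight (u ++ 𝐛 ∷ v) σ)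
        ≈⟨ ΣL-congAll (perms M) (perms-shape M) (λ {σ} (|σ| , _) → cutσ σ |σ|) ⟩
      ΣL (perms M) (λ σ → splitTerm (weight u) (weight v) (take (suc |u|) σ) (drop (suc |u|) σ))
        ≈⟨ shuffle-decomposition M (suc |u|) (suc |v|) P.refl (weight u) (weight v) ⟩
      qbinom (suc |u|) (suc |v|) * (Σperm (weight u) (suc |u|) * Σperm (weight v) (suc |v|))
        ≈⟨ *-congˡ (*-cong (β-as-sum u (suc |u|) P.refl) (β-as-sum v (suc |v|) P.refl)) ⟨
      qbinom (suc |u|) (suc |v|) * (β q u * β q v) ∎
      where
      |u| |v| M : ℕ
      |u| = length u
      |v| = length v
      M = suc |u| N.+ suc |v|
      |uav| : ∀ {x} → suc (length (u ++ x ∷ v)) ≡ M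
      |uav| = P.cong suc (LP.length-++ u)
      cutσ : ∀ σ → length σ ≡ M → weight (u ++ 𝐚 ∷ v) σ + weight (u ++ 𝐛 ∷ v) σ
                                   ≈ splitTerm (weight u) (weight v) (take (suc |u|) σ) (drop (suc |u|) σ)
      cutσ σ |σ| = begin
        weight (u ++ 𝐚 ∷ v) σ + weight (u ++ 𝐛 ∷ v) σ
          ≡⟨ P.cong (λ τ → weight (u ++ 𝐚 ∷ v) τ + weight (u ++ 𝐛 ∷ v) τ) (LP.take++drop≡id (suc |u|) σ) ⟨
        weight (u ++ 𝐚 ∷ v) (take (suc |u|) σ ++ drop (suc |u|) σ) + weight (u ++ 𝐛 ∷ v) (take (suc |u|) σ ++ drop (suc |u|) σ)
          ≈⟨ weight-split u v (take (suc |u|) σ) (drop (suc |u|) σ)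
                          (length-take-+ (suc |u|) (suc |v|) σ |σ|) (length-drop-+ (suc |u|) (suc |v|) σ |σ|) ⟩
        splitTerm (weight u) (weight v) (take (suc |u|) σ) (drop (suc |u|) σ) ∎

    coefficient-product : (finv : ℕ → Carrier) → (∀ n → qfact q n * finv n ≈ 1#) →
      (u v : ℕ → Word) →
      (∀ n → 1 N.≤ n → length (u n) ≡ n ∸ 1) → (∀ n → 1 N.≤ n → length (v n) ≡ n ∸ 1) →
      (c d : ℕ → Carrier) → ∀ i J → 1 N.≤ J →
      egf q finv c u (suc i) * egf q finv d v J
      ≈ c (suc i) * d J * (β q (u (suc i) ++ 𝐚 ∷ v J) + β q (u (suc i) ++ 𝐛 ∷ v J)) * finv (suc i N.+ J)
    coefficient-product finv inverse u v |u| |v| c d i (suc j) _ = sym (begin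
      C * D * (β q (U ++ 𝐚 ∷ V) + β q (U ++ 𝐛 ∷ V)) * fN
        ≈⟨ *-congʳ (*-congˡ (β-split U V)) ⟩
      C * D * (qbinom (suc (length U)) (suc (length V)) * (βU * βV)) * fN
        ≡⟨ P.cong₂ (λ a b → C * D * (qbinom (suc a) (suc b) * (βU * βV)) * fN)
                   (|u| (suc i) (s≤s z≤n)) (|v| (suc j) (s≤s z≤n)) ⟩
      C * D * (Q * (βU * βV)) * fN
        ≈⟨ solve 6 (λ c d x bu bv fn → c :* d :* (x :* (bu :* bv)) :* fn := (c :* bu) :* (d :* bv) :* (x :* fn))
                   refl C D Q βU βV fN ⟩
      (C * βU) * (D * βV) * (Q * fN)
        ≈⟨ *-congˡ (qbinom-finv finv inverse (suc i) (suc j)) ⟩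
      (C * βU) * (D * βV) * (finv (suc i) * finv (suc j))
        ≈⟨ solve 6 (λ c d bu bv fi fj → (c :* bu) :* (d :* bv) :* (fi :* fj) := (c :* bu :* fi) :* (d :* bv :* fj))
                   refl C D βU βV (finv (suc i)) (finv (suc j)) ⟩
      egf q finv c u (suc i) * egf q finv d v (suc j) ∎)
      where
      U V : Word
      U = u (suc i)
      V = v (suc j)
      C D βU βV fN Q : Carrier
      C  = c (suc i)
      D  = d (suc j)
      βU = β q U
      βV = β q V
      fN = finv (suc i N.+ suc j)
      Q  = qbinom (suc i) (suc j)


-- Both series lack a constant term, so the coefficient of x^{n+1} of
-- the product is Σ_{k<n} of the products of the coefficients of x^{k+1} and
-- x^{n-k}, each of which is the corresponding summand of the right-hand side.
lemma5p2 : {ℓc ℓ : Level} (R : CommutativeRing ℓc ℓ) →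
    let open CommutativeRing R in
    let open Series R in
    (q : Carrier) (finv : ℕ → Carrier) →
    (∀ n → qfact q n * finv n ≈ 1#) →
    (u v : ℕ → Word) →
    (∀ n → 1 ≤ n → length (u n) ≡ n ∸ 1) →
    (∀ n → 1 ≤ n → length (v n) ≡ n ∸ 1) →
    (c d : ℕ → Carrier) →
    ∀ n → cauchy (egf q finv c u) (egf q finv d v) n ≈ rhs q finv c u d v n
lemma5p2 R q finv inverse u v |u| |v| c d = coefficient
  where
  open CommutativeRing R hiding (zero)
  open Series R
  open QAnalogue R
  open SetoidReasoning setoid

  summand : ℕ → ℕ → Carrier
  summand n k = c (suc k) * d (n ∸ k) * (β q (u (suc k) ++ 𝐚 ∷ v (n ∸ k)) + β q (u (suc k) ++ 𝐛 ∷ v (n ∸ k)))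

  coefficient : ∀ n → cauchy (egf q finv c u) (egf q finv d v) n ≈ rhs q finv c u d v n
  coefficient zero    = trans (trans (+-identityˡ _) (zeroˡ _)) (sym (zeroˡ _))
  coefficient (suc n) = begin
    cauchy (egf q finv c u) (egf q finv d v) (suc n)
      ≈⟨ cauchy-interior (egf q finv c u) (egf q finv d v) refl refl n ⟩
    sumRange n (λ k → egf q finv c u (suc k) * egf q finv d v (n ∸ k))
      ≈⟨ sumRange-cong< n (λ k k<n →
           trans (coefficient-product q finv inverse u v |u| |v| c d k (n ∸ k) (NP.m<n⇒0<n∸m k<n))
                 (*-congˡ (reflexive (P.cong (finv ∘ suc) (NP.m+[n∸m]≡n (NP.<⇒≤ k<n)))))) ⟩
    sumRange n (λ k → summand n k * finv (suc n))
      ≈⟨ sumRange-*ʳ n (summand n) (finv (suc n)) ⟨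
    rhs q finv c u d v (suc n) ∎
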